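{- Let $n\ge0$ and let $Q_n$ be identified with the set of lattice paths with $n$ steps from $\{U,D\}$ starting at $(0,0)$, so that $p\le q$ iff $p_i\le q_i$ for all $i$ (heights after $i$ steps). Define $A(p,q)$, for $(p,q)\in Q_n\times Q_n$, as the path whose $i$th step is $U$, $D$, $O_1$, $O_2$ according as the pair of $i$th steps of $(p,q)$ is $(D,U)$, $(U,D)$, $(U,U)$, $(D,D)$. Then $A$ is a bijection from $Q_n\times Q_n$ onto $\mathcal V_n$ satisfying $d(p,q)=\overline d(A(p,q))$, where $d(p,q)$ is the distance in the Hasse diagram of $Q_n$, and $A$ restricts to a bijection from $\{(p,q):p\le q\}$ onto $\mathcal N_n$.
   Context: $Q_n$ is the lattice (under inclusion) of order ideals of the shifted staircase poset $\{(i,j):1\le i\le j\le n\}$ with componentwise order; it is isomorphic to the poset of $U/D$ paths of length $n$ from $(0,0)$ ordered by heightwise comparison. Steps: $U=(1,1)$, $D=(1,-1)$, and two distinguishable horizontal steps $O_1,O_2$, each $(1,0)$. $\mathcal V_n$ is the set of lattice paths with $n$ steps from $\{U,D,O_1,O_2\}$ starting at $(0,0)$ (bilateral Motzkin prefixes); $\mathcal N_n$ is the subset staying weakly above the $x$-axis. For a path $r$ with heights $r_0,\dots,r_n$, $\overline d(r)=\sum_{i=0}^n|r_i|$. -}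

module Defs where

import Data.Nat
import Data.Product
open import Data.Nat using (ℕ; zero; suc; _+_)
open import Data.Integer as ℤ using (ℤ; 0ℤ; 1ℤ; -1ℤ; ∣_∣)
open import Data.Fin using (Fin)
open import Data.Vec using (Vec; []; _∷_; map; lookup; foldr)
open import Data.Sum using (_⊎_)
open import Data.Product using (_×_)
open import Relation.Binary.PropositionalEquality using (_≡_)
open import Relation.Nullary using (¬_)

data UD : Set where
  U D : UD

data Step : Set where
  U D O₁ O₂ : Step

Q : ℕ → Set
Q n = Vec UD n

V : ℕ → Set
V n = Vec Step n

udInc : UD → ℤ
udInc U = 1ℤ
udInc D = -1ℤ

stepInc : Step → ℤ
stepInc U = 1ℤ
stepInc D = -1ℤ
stepInc O₁ = 0ℤ
stepInc O₂ = 0ℤ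

heightsQ : ∀ {n} → Q n → Vec ℤ (suc n)
heightsQ [] = 0ℤ ∷ []
heightsQ (s ∷ ss) = 0ℤ ∷ map (λ h → udInc s ℤ.+ h) (heightsQ ss)

heightsV : ∀ {n} → V n → Vec ℤ (suc n)
heightsV [] = 0ℤ ∷ []
heightsV (s ∷ ss) = 0ℤ ∷ map (λ h → stepInc s ℤ.+ h) (heightsV ss)

_≤Q_ : ∀ {n} → Q n → Q n → Set
_≤Q_ {n} p q = ∀ (i : Fin (suc n)) → lookup (heightsQ p) i ℤ.≤ lookup (heightsQ q) i

_⋖_ : ∀ {n} → Q n → Q n → Set
_⋖_ {n} p q = p ≤Q q × ¬ (p ≡ q) × (∀ (r : Q n) → p ≤Q r → r ≤Q q → (r ≡ p ⊎ r ≡ q))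

HasseAdj : ∀ {n} → Q n → Q n → Set
HasseAdj p q = p ⋖ q ⊎ q ⋖ p

data Walk {n : ℕ} : Q n → Q n → ℕ → Set where
  nil  : ∀ {p} → Walk p p zero
  cons : ∀ {p r q k} → HasseAdj p r → Walk r q k → Walk p q (suc k)

HasseDist : ∀ {n} → Q n → Q n → ℕ → Set
HasseDist p q k = Walk p q k × (∀ m → Walk p q m → k Data.Nat.≤ m)

dbar : ∀ {n} → V n → ℕ
dbar r = foldr (λ _ → ℕ) (λ h acc → ∣ h ∣ + acc) 0 (heightsV r)

InN : ∀ {n} → V n → Set
InN {n} r = ∀ (i : Fin (suc n)) → 0ℤ ℤ.≤ lookup (heightsV r) i

stepA : UD → UD → Step
stepA D U = U
stepA U D = D
stepA U U = O₁
stepA D D = O₂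

A : ∀ {n} → Q n → Q n → V n
A [] [] = []
A (a ∷ p) (b ∷ q) = stepA a b ∷ A p q

Apair : ∀ {n} → Q n × Q n → V n
Apair (p Data.Product., q) = A p q

-- The heights h_i of A(p,q) are (q_i − p_i)/2, so p ≤ q exactly when A(p,q) stays weakly
-- above the axis, and d̄(A(p,q)) = Σ|h_i| is symmetric and satisfies the triangle
-- inequality.  A cover of Q_n turns a valley DU (or a final D) into UD (or U), moving one
-- height by 2, so adjacent paths are at d̄-distance at most 1 and every walk from p to q
-- has length at least d̄(A(p,q)).  Conversely, if some h_i > 0 then p has a valley inside
-- a positive stretch of h, and flipping it lowers Σ|h_i| by 1; if h ≤ 0 the same holds
-- for q.  Following these flips gives a walk of length d̄(A(p,q)).
module Submission where

open import Defs
open import Data.Nat using (ℕ)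
open import Data.Product using (_×_; _,_; ∃; ∃-syntax)
open import Relation.Binary.PropositionalEquality using (_≡_)
open import Function.Definitions using (Bijective)

open import Data.Nat as ℕ using (zero; suc; z≤n)
import Data.Nat.Properties as ℕ
open import Data.Integer as ℤ using (ℤ; 0ℤ; 1ℤ; -1ℤ; -[1+_]; ∣_∣; _+_; _-_; -_; _≤_; _<_; +≤+; +<+)
import Data.Integer.Properties as ℤ
open import Data.Integer.Tactic.RingSolver using (solve-∀)
import Algebra.Properties.CommutativeSemigroup ℤ.+-commutativeSemigroup as ℤ+
import Algebra.Properties.CommutativeSemigroup ℕ.+-commutativeSemigroup as ℕ+
open import Data.Vec using (Vec; []; _∷_; map; zipWith; lookup; foldr)
import Data.Vec.Properties as Vec
open import Data.Vec.Relation.Unary.All as All using (All; []; _∷_)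
import Data.Vec.Relation.Unary.All.Properties as All
open import Data.Product using (uncurry; zip′)
open import Data.Sum as Sum using (_⊎_; inj₁; inj₂)
open import Function using (_∘_)
open import Function.Consequences.Propositional
  using (inverseᵇ⇒bijective; strictlyInverseˡ⇒inverseˡ; strictlyInverseʳ⇒inverseʳ)
open import Relation.Binary.PropositionalEquality
  using (_≢_; refl; sym; trans; cong; cong₂; subst; module ≡-Reasoning)
open import Relation.Nullary using (¬_; yes; no; contradiction)

open ≡-Reasoning

unstepA : Step → UD × UD
unstepA U  = D , U
unstepA D  = U , D
unstepA O₁ = U , U
unstepA O₂ = D , D

stepA-unstepA : ∀ s → uncurry stepA (unstepA s) ≡ s
stepA-unstepA U  = refl
stepA-unstepA D  = refl
stepA-unstepA O₁ = refl
stepA-unstepA O₂ = refl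

unstepA-stepA : ∀ a b → unstepA (stepA a b) ≡ (a , b)
unstepA-stepA U U = refl
unstepA-stepA U D = refl
unstepA-stepA D U = refl
unstepA-stepA D D = refl

A⁻¹ : ∀ {n} → V n → Q n × Q n
A⁻¹ []      = [] , []
A⁻¹ (s ∷ v) = zip′ _∷_ _∷_ (unstepA s) (A⁻¹ v)

A-A⁻¹ : ∀ {n} (v : V n) → Apair (A⁻¹ v) ≡ v
A-A⁻¹ []      = refl
A-A⁻¹ (s ∷ v) = cong₂ _∷_ (stepA-unstepA s) (A-A⁻¹ v)

A⁻¹-A : ∀ {n} (pq : Q n × Q n) → A⁻¹ (Apair pq) ≡ pq
A⁻¹-A ([] , [])         = refl
A⁻¹-A (a ∷ p , b ∷ q) = cong₂ (zip′ _∷_ _∷_) (unstepA-stepA a b) (A⁻¹-A (p , q))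

A-bijective : ∀ {n} → Bijective _≡_ _≡_ (Apair {n})
A-bijective = inverseᵇ⇒bijective
  (strictlyInverseˡ⇒inverseˡ Apair A-A⁻¹ , strictlyInverseʳ⇒inverseʳ Apair A⁻¹-A)

heightsFrom : ∀ {n} {S : Set} → (S → ℤ) → ℤ → Vec S n → Vec ℤ (suc n)
heightsFrom inc x []       = x ∷ []
heightsFrom inc x (s ∷ ss) = x ∷ heightsFrom inc (x + inc s) ss

head-heightsFrom : ∀ {n} {S : Set} {P : ℤ → Set} {inc : S → ℤ} {x} (ss : Vec S n) →
                   All P (heightsFrom inc x ss) → P x
head-heightsFrom []      (px ∷ _) = px
head-heightsFrom (_ ∷ _) (px ∷ _) = px

map-heightsFrom : ∀ {n} {S : Set} (inc : S → ℤ) x y (ss : Vec S n) →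
                  map (x +_) (heightsFrom inc y ss) ≡ heightsFrom inc (x + y) ss
map-heightsFrom inc x y []       = refl
map-heightsFrom inc x y (s ∷ ss) = cong (x + y ∷_) (begin
  map (x +_) (heightsFrom inc (y + inc s) ss) ≡⟨ map-heightsFrom inc x (y + inc s) ss ⟩
  heightsFrom inc (x + (y + inc s)) ss        ≡⟨ cong (λ z → heightsFrom inc z ss) (ℤ.+-assoc x y (inc s)) ⟨
  heightsFrom inc (x + y + inc s) ss          ∎)

heights≡heightsFrom : ∀ {S : Set} (inc : S → ℤ) (H : ∀ {m} → Vec S m → Vec ℤ (suc m)) →
  H [] ≡ 0ℤ ∷ [] → (∀ {m} s (ss : Vec S m) → H (s ∷ ss) ≡ 0ℤ ∷ map (inc s +_) (H ss)) →
  ∀ {n} (ss : Vec S n) → H ss ≡ heightsFrom inc 0ℤ ss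
heights≡heightsFrom inc H H[] H∷ []       = H[]
heights≡heightsFrom inc H H[] H∷ (s ∷ ss) = begin
  H (s ∷ ss)                                 ≡⟨ H∷ s ss ⟩
  0ℤ ∷ map (inc s +_) (H ss)                 ≡⟨ cong (λ hs → 0ℤ ∷ map (inc s +_) hs) (heights≡heightsFrom inc H H[] H∷ ss) ⟩
  0ℤ ∷ map (inc s +_) (heightsFrom inc 0ℤ ss) ≡⟨ cong (0ℤ ∷_) (map-heightsFrom inc (inc s) 0ℤ ss) ⟩
  0ℤ ∷ heightsFrom inc (inc s + 0ℤ) ss       ≡⟨ cong (λ z → 0ℤ ∷ heightsFrom inc z ss) (ℤ.+-comm (inc s) 0ℤ) ⟩
  heightsFrom inc 0ℤ (s ∷ ss)                ∎

heightsQ≡heightsFrom : ∀ {n} (p : Q n) → heightsQ p ≡ heightsFrom udInc 0ℤ p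
heightsQ≡heightsFrom = heights≡heightsFrom udInc heightsQ refl (λ _ _ → refl)

heightsV≡heightsFrom : ∀ {n} (v : V n) → heightsV v ≡ heightsFrom stepInc 0ℤ v
heightsV≡heightsFrom = heights≡heightsFrom stepInc heightsV refl (λ _ _ → refl)

gapStep : UD → UD → ℤ
gapStep a b = stepInc (stepA a b)

-- If p and q start at heights x and x + 2c, then halfGap c p q lists (q_i − p_i)/2.
halfGap : ∀ {n} → ℤ → Q n → Q n → Vec ℤ (suc n)
halfGap c p q = heightsFrom stepInc c (A p q)

gapStep-half : ∀ a b → udInc b - udInc a ≡ gapStep a b + gapStep a b
gapStep-half U U = refl
gapStep-half U D = refl
gapStep-half D U = refl
gapStep-half D D = refl

gapStep-refl : ∀ a → gapStep a a ≡ 0ℤ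
gapStep-refl U = refl
gapStep-refl D = refl

gapStep-swap : ∀ a b → gapStep b a ≡ - gapStep a b
gapStep-swap U U = refl
gapStep-swap U D = refl
gapStep-swap D U = refl
gapStep-swap D D = refl

gapStep-trans : ∀ a m b → gapStep a b ≡ gapStep a m + gapStep m b
gapStep-trans U U U = refl
gapStep-trans U U D = refl
gapStep-trans U D U = refl
gapStep-trans U D D = refl
gapStep-trans D U U = refl
gapStep-trans D U D = refl
gapStep-trans D D U = refl
gapStep-trans D D D = refl

gapStep-U≡pred : ∀ b → gapStep U b ≡ ℤ.pred (gapStep D b)
gapStep-U≡pred U = refl
gapStep-U≡pred D = refl

gapStep-UD≡DU : ∀ b b′ → gapStep U b + gapStep D b′ ≡ gapStep D b + gapStep U b′
gapStep-UD≡DU U U = refl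
gapStep-UD≡DU U D = refl
gapStep-UD≡DU D U = refl
gapStep-UD≡DU D D = refl

c+gapStep-U≤c : ∀ c b → c + gapStep U b ≤ c
c+gapStep-U≤c c U = ℤ.≤-reflexive (ℤ.+-identityʳ c)
c+gapStep-U≤c c D = ℤ.i-j≤i c 1ℤ

c≤c+gapStep-D : ∀ c b → c ≤ c + gapStep D b
c≤c+gapStep-D c U = ℤ.i≤i+j c 1ℤ
c≤c+gapStep-D c D = ℤ.≤-reflexive (sym (ℤ.+-identityʳ c))

heights-difference : ∀ {n x y c} (p q : Q n) → y - x ≡ c + c →
  zipWith _-_ (heightsFrom udInc y q) (heightsFrom udInc x p) ≡ map (λ h → h + h) (halfGap c p q)
heights-difference [] [] e = cong (_∷ []) e
heights-difference {x = x} {y} {c} (a ∷ p) (b ∷ q) e =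
  cong₂ _∷_ e (heights-difference p q (begin
    (y + udInc b) - (x + udInc a)          ≡⟨ difference-of-sums y (udInc b) x (udInc a) ⟩
    (y - x) + (udInc b - udInc a)          ≡⟨ cong₂ _+_ e (gapStep-half a b) ⟩
    (c + c) + (gapStep a b + gapStep a b)  ≡⟨ ℤ+.interchange c c (gapStep a b) (gapStep a b) ⟩
    (c + gapStep a b) + (c + gapStep a b)  ∎))
  where
  difference-of-sums : ∀ y u x v → (y + u) - (x + v) ≡ (y - x) + (u - v)
  difference-of-sums = solve-∀

height-difference : ∀ {n} (p q : Q n) i → let h = lookup (heightsV (A p q)) i in
                    lookup (heightsQ q) i - lookup (heightsQ p) i ≡ h + h
height-difference p q i = begin
  lookup (heightsQ q) i - lookup (heightsQ p) i
    ≡⟨ Vec.lookup-zipWith _-_ i (heightsQ q) (heightsQ p) ⟨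
  lookup (zipWith _-_ (heightsQ q) (heightsQ p)) i
    ≡⟨ cong₂ (λ hq hp → lookup (zipWith _-_ hq hp) i) (heightsQ≡heightsFrom q) (heightsQ≡heightsFrom p) ⟩
  lookup (zipWith _-_ (heightsFrom udInc 0ℤ q) (heightsFrom udInc 0ℤ p)) i
    ≡⟨ cong (λ hs → lookup hs i) (heights-difference p q refl) ⟩
  lookup (map (λ h → h + h) (halfGap 0ℤ p q)) i
    ≡⟨ Vec.lookup-map i (λ h → h + h) (halfGap 0ℤ p q) ⟩
  lookup (halfGap 0ℤ p q) i + lookup (halfGap 0ℤ p q) i
    ≡⟨ cong (λ hs → lookup hs i + lookup hs i) (heightsV≡heightsFrom (A p q)) ⟨
  lookup (heightsV (A p q)) i + lookup (heightsV (A p q)) i ∎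

0≤h+h⇒0≤h : ∀ h → 0ℤ ≤ h + h → 0ℤ ≤ h
0≤h+h⇒0≤h (ℤ.+ _)  _  = +≤+ z≤n
0≤h+h⇒0≤h -[1+ _ ] ()

≤Q⇒InN : ∀ {n} (p q : Q n) → p ≤Q q → InN (A p q)
≤Q⇒InN p q p≤q i =
  0≤h+h⇒0≤h _ (subst (0ℤ ≤_) (height-difference p q i) (ℤ.i≤j⇒0≤j-i (p≤q i)))

InN⇒≤Q : ∀ {n} (p q : Q n) → InN (A p q) → p ≤Q q
InN⇒≤Q p q 0≤A i =
  ℤ.0≤i-j⇒j≤i (subst (0ℤ ≤_) (sym (height-difference p q i)) (ℤ.+-mono-≤ (0≤A i) (0≤A i)))

NonNeg NonPos : ∀ {m} → Vec ℤ m → Set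
NonNeg = All (0ℤ ≤_)
NonPos = All (_≤ 0ℤ)

≤Q⇒nonNeg : ∀ {n} {p q : Q n} → p ≤Q q → NonNeg (halfGap 0ℤ p q)
≤Q⇒nonNeg {p = p} {q} = subst NonNeg (heightsV≡heightsFrom (A p q)) ∘ All.lookup⁻ ∘ ≤Q⇒InN p q

nonNeg⇒≤Q : ∀ {n} {p q : Q n} → NonNeg (halfGap 0ℤ p q) → p ≤Q q
nonNeg⇒≤Q {p = p} {q} = InN⇒≤Q p q ∘ All.lookup⁺ ∘ subst NonNeg (sym (heightsV≡heightsFrom (A p q)))

¬nonNeg-halfGap-1 : ∀ {n} (p q : Q n) → ¬ NonNeg (halfGap -1ℤ p q)
¬nonNeg-halfGap-1 p q h with head-heightsFrom (A p q) h
... | ()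

nonNeg-antisym : ∀ {n} (p q : Q n) → NonNeg (halfGap 0ℤ p q) → NonNeg (halfGap 0ℤ q p) → p ≡ q
nonNeg-antisym []      []      _       _       = refl
nonNeg-antisym (U ∷ p) (U ∷ q) (_ ∷ h) (_ ∷ k) = cong (U ∷_) (nonNeg-antisym p q h k)
nonNeg-antisym (D ∷ p) (D ∷ q) (_ ∷ h) (_ ∷ k) = cong (D ∷_) (nonNeg-antisym p q h k)
nonNeg-antisym (U ∷ p) (D ∷ q) (_ ∷ h) _       = contradiction h (¬nonNeg-halfGap-1 p q)
nonNeg-antisym (D ∷ p) (U ∷ q) _       (_ ∷ k) = contradiction k (¬nonNeg-halfGap-1 q p)

halfGap-swap : ∀ {n} c (p q : Q n) → halfGap (- c) q p ≡ map -_ (halfGap c p q)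
halfGap-swap c []      []      = refl
halfGap-swap c (a ∷ p) (b ∷ q) = cong (- c ∷_) (begin
  halfGap (- c + gapStep b a) q p   ≡⟨ cong (λ z → halfGap (- c + z) q p) (gapStep-swap a b) ⟩
  halfGap (- c + - gapStep a b) q p ≡⟨ cong (λ z → halfGap z q p) (ℤ.neg-distrib-+ c (gapStep a b)) ⟨
  halfGap (- (c + gapStep a b)) q p ≡⟨ halfGap-swap (c + gapStep a b) p q ⟩
  map -_ (halfGap (c + gapStep a b) p q) ∎)

nonPos⇒nonNeg-swap : ∀ {n} {p q : Q n} → NonPos (halfGap 0ℤ p q) → NonNeg (halfGap 0ℤ q p)
nonPos⇒nonNeg-swap {p = p} {q} =
  subst NonNeg (sym (halfGap-swap 0ℤ p q)) ∘ All.map⁺ ∘ All.map ℤ.neg-mono-≤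

halfGap-trans : ∀ {n} c₁ c₂ (p r q : Q n) →
                halfGap (c₁ + c₂) p q ≡ zipWith _+_ (halfGap c₁ p r) (halfGap c₂ r q)
halfGap-trans c₁ c₂ []      []      []      = refl
halfGap-trans c₁ c₂ (a ∷ p) (m ∷ r) (b ∷ q) = cong (c₁ + c₂ ∷_) (begin
  halfGap (c₁ + c₂ + gapStep a b) p q
    ≡⟨ cong (λ z → halfGap (c₁ + c₂ + z) p q) (gapStep-trans a m b) ⟩
  halfGap (c₁ + c₂ + (gapStep a m + gapStep m b)) p q
    ≡⟨ cong (λ z → halfGap z p q) (ℤ+.interchange c₁ c₂ (gapStep a m) (gapStep m b)) ⟩
  halfGap ((c₁ + gapStep a m) + (c₂ + gapStep m b)) p q
    ≡⟨ halfGap-trans (c₁ + gapStep a m) (c₂ + gapStep m b) p r q ⟩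
  zipWith _+_ (halfGap (c₁ + gapStep a m) p r) (halfGap (c₂ + gapStep m b) r q) ∎)

absSum : ∀ {m} → Vec ℤ m → ℕ
absSum = foldr (λ _ → ℕ) (λ h acc → ∣ h ∣ ℕ.+ acc) 0

absSum-neg : ∀ {m} (xs : Vec ℤ m) → absSum (map -_ xs) ≡ absSum xs
absSum-neg []       = refl
absSum-neg (x ∷ xs) = cong₂ ℕ._+_ (ℤ.∣-i∣≡∣i∣ x) (absSum-neg xs)

absSum-zipWith-+ : ∀ {m} (xs ys : Vec ℤ m) → absSum (zipWith _+_ xs ys) ℕ.≤ absSum xs ℕ.+ absSum ys
absSum-zipWith-+ []       []       = z≤n
absSum-zipWith-+ (x ∷ xs) (y ∷ ys) = ℕ.≤-trans
  (ℕ.+-mono-≤ (ℤ.∣i+j∣≤∣i∣+∣j∣ x y) (absSum-zipWith-+ xs ys))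
  (ℕ.≤-reflexive (ℕ+.interchange ∣ x ∣ ∣ y ∣ (absSum xs) (absSum ys)))

gapSize : ∀ {n} → ℤ → Q n → Q n → ℕ
gapSize c p q = absSum (halfGap c p q)

dbar≡gapSize : ∀ {n} (p q : Q n) → dbar (A p q) ≡ gapSize 0ℤ p q
dbar≡gapSize p q = cong absSum (heightsV≡heightsFrom (A p q))

gapSize-refl : ∀ {n} (p : Q n) → gapSize 0ℤ p p ≡ 0
gapSize-refl []      = refl
gapSize-refl (a ∷ p) = trans (cong (λ z → gapSize (0ℤ + z) p p) (gapStep-refl a)) (gapSize-refl p)

gapSize-sym : ∀ {n} (p q : Q n) → gapSize 0ℤ q p ≡ gapSize 0ℤ p q
gapSize-sym p q = trans (cong absSum (halfGap-swap 0ℤ p q)) (absSum-neg (halfGap 0ℤ p q))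

gapSize-triangle : ∀ {n} (p r q : Q n) → gapSize 0ℤ p q ℕ.≤ gapSize 0ℤ p r ℕ.+ gapSize 0ℤ r q
gapSize-triangle p r q = ℕ.≤-trans
  (ℕ.≤-reflexive (cong absSum (halfGap-trans 0ℤ 0ℤ p r q)))
  (absSum-zipWith-+ (halfGap 0ℤ p r) (halfGap 0ℤ r q))

data Flip : ∀ {n} → Q n → Q n → Set where
  valley : ∀ {n} {p : Q n} → Flip (D ∷ U ∷ p) (U ∷ D ∷ p)
  final  : Flip (D ∷ []) (U ∷ [])
  there  : ∀ {n a} {p r : Q n} → Flip p r → Flip (a ∷ p) (a ∷ r)

flip-≢ : ∀ {n} {p r : Q n} → Flip p r → p ≢ r
flip-≢ valley    ()
flip-≢ final     ()
flip-≢ (there f) refl = flip-≢ f refl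

nonNeg-refl : ∀ {n} (p : Q n) → NonNeg (halfGap 0ℤ p p)
nonNeg-refl []      = +≤+ z≤n ∷ []
nonNeg-refl (U ∷ p) = +≤+ z≤n ∷ nonNeg-refl p
nonNeg-refl (D ∷ p) = +≤+ z≤n ∷ nonNeg-refl p

flip-nonNeg : ∀ {n} {p r : Q n} → Flip p r → NonNeg (halfGap 0ℤ p r)
flip-nonNeg (valley {p = p})  = +≤+ z≤n ∷ +≤+ z≤n ∷ nonNeg-refl p
flip-nonNeg final             = +≤+ z≤n ∷ +≤+ z≤n ∷ []
flip-nonNeg (there {a = U} f) = +≤+ z≤n ∷ flip-nonNeg f
flip-nonNeg (there {a = D} f) = +≤+ z≤n ∷ flip-nonNeg f

flip-sandwich : ∀ {n} {p r : Q n} → Flip p r → ∀ s →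
                NonNeg (halfGap 0ℤ p s) → NonNeg (halfGap 0ℤ s r) → s ≡ p ⊎ s ≡ r
flip-sandwich final (D ∷ []) _ _ = inj₁ refl
flip-sandwich final (U ∷ []) _ _ = inj₂ refl
flip-sandwich (valley {p = p}) (D ∷ U ∷ s) (_ ∷ _ ∷ h) (_ ∷ _ ∷ k) =
  inj₁ (cong (λ t → D ∷ U ∷ t) (nonNeg-antisym s p k h))
flip-sandwich (valley {p = p}) (U ∷ D ∷ s) (_ ∷ _ ∷ h) (_ ∷ _ ∷ k) =
  inj₂ (cong (λ t → U ∷ D ∷ t) (nonNeg-antisym s p k h))
flip-sandwich (valley {p = p}) (U ∷ U ∷ s) _ (_ ∷ _ ∷ k) = contradiction k (¬nonNeg-halfGap-1 s p)
flip-sandwich (valley {p = p}) (D ∷ D ∷ s) (_ ∷ _ ∷ h) _ = contradiction h (¬nonNeg-halfGap-1 p s)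
flip-sandwich (there {a = U} f) (U ∷ s) (_ ∷ h) (_ ∷ k) =
  Sum.map (cong (U ∷_)) (cong (U ∷_)) (flip-sandwich f s h k)
flip-sandwich (there {a = D} f) (D ∷ s) (_ ∷ h) (_ ∷ k) =
  Sum.map (cong (D ∷_)) (cong (D ∷_)) (flip-sandwich f s h k)
flip-sandwich (there {a = U} {p = p} f) (D ∷ s) (_ ∷ h) _ = contradiction h (¬nonNeg-halfGap-1 p s)
flip-sandwich (there {a = D} {r = r} f) (U ∷ s) _ (_ ∷ k) = contradiction k (¬nonNeg-halfGap-1 s r)

flip⇒⋖ : ∀ {n} {p r : Q n} → Flip p r → p ⋖ r
flip⇒⋖ f = nonNeg⇒≤Q (flip-nonNeg f) , flip-≢ f ,
  λ s p≤s s≤r → flip-sandwich f s (≤Q⇒nonNeg p≤s) (≤Q⇒nonNeg s≤r)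

data Decrement : ∀ {m} → Vec ℤ m → Vec ℤ m → Set where
  here  : ∀ {m k} {xs : Vec ℤ m} → Decrement (ℤ.+[1+ k ] ∷ xs) (ℤ.+ k ∷ xs)
  there : ∀ {m x} {xs ys : Vec ℤ m} → Decrement xs ys → Decrement (x ∷ xs) (x ∷ ys)

decrement : ∀ {m x y} {xs ys : Vec ℤ m} → 0ℤ < x → y ≡ ℤ.pred x → ys ≡ xs →
            Decrement (x ∷ xs) (y ∷ ys)
decrement {x = ℤ.+[1+ _ ]} _         refl refl = here
decrement {x = ℤ.+0}       (+<+ ())  _    _
decrement {x = -[1+ _ ]}   ()        _    _

absSum-decrement : ∀ {m} {xs ys : Vec ℤ m} → Decrement xs ys → absSum xs ≡ suc (absSum ys)
absSum-decrement here = refl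
absSum-decrement (there {x = x} {ys = ys} d) =
  trans (cong (∣ x ∣ ℕ.+_) (absSum-decrement d)) (ℕ.+-suc ∣ x ∣ (absSum ys))

nonNeg-decrement : ∀ {m} {xs ys : Vec ℤ m} → Decrement xs ys → NonNeg xs → NonNeg ys
nonNeg-decrement here      (_ ∷ h)  = +≤+ z≤n ∷ h
nonNeg-decrement (there d) (h ∷ hs) = h ∷ nonNeg-decrement d hs

data StartsUp : ∀ {n} → Q n → Set where
  empty : StartsUp []
  headU : ∀ {n} {p : Q n} → StartsUp (U ∷ p)

-- pending: the half-gap starts positive where p cannot be raised, so a D step put in
-- front of p creates a valley whose flip brings p closer to q.
data FlipTowards {n} (c : ℤ) (p q : Q n) : Set where
  flipUp  : (r : Q n) → Flip p r → Decrement (halfGap c p q) (halfGap c r q) →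
            FlipTowards c p q
  below   : NonPos (halfGap c p q) → FlipTowards c p q
  pending : 0ℤ < c → StartsUp p → FlipTowards c p q

c+gapStep-U≡pred : ∀ c b → c + gapStep U b ≡ ℤ.pred (c + gapStep D b)
c+gapStep-U≡pred c b = trans (cong (c +_) (gapStep-U≡pred b)) (ℤ.+-pred c (gapStep D b))

valley-offset : ∀ c b b′ → c + gapStep U b + gapStep D b′ ≡ c + gapStep D b + gapStep U b′
valley-offset c b b′ = begin
  c + gapStep U b + gapStep D b′   ≡⟨ ℤ.+-assoc c (gapStep U b) (gapStep D b′) ⟩
  c + (gapStep U b + gapStep D b′) ≡⟨ cong (c +_) (gapStep-UD≡DU b b′) ⟩
  c + (gapStep D b + gapStep U b′) ≡⟨ ℤ.+-assoc c (gapStep D b) (gapStep U b′) ⟨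
  c + gapStep D b + gapStep U b′   ∎

valleyFlip : ∀ {n} c b (p q : Q n) → StartsUp p → 0ℤ < c + gapStep D b →
             FlipTowards c (D ∷ p) (b ∷ q)
valleyFlip c b []      []       empty pos =
  flipUp (U ∷ []) final (there (decrement pos (c+gapStep-U≡pred c b) refl))
valleyFlip c b (U ∷ p) (b′ ∷ q) headU pos =
  flipUp (U ∷ D ∷ p) valley (there (decrement pos (c+gapStep-U≡pred c b)
    (cong (λ z → halfGap z p q) (valley-offset c b b′))))

flipTowards : ∀ {n} c (p q : Q n) → FlipTowards c p q
flipTowards c [] [] with c ℤ.≤? 0ℤ
... | yes c≤0 = below (c≤0 ∷ [])
... | no  c≰0 = pending (ℤ.≰⇒> c≰0) empty
flipTowards c (a ∷ p) (b ∷ q) with flipTowards (c + gapStep a b) p q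
... | flipUp r f d  = flipUp (a ∷ r) (there f) (there d)
... | below np      = extendBelow a np
  where
  extendBelow : ∀ a → NonPos (halfGap (c + gapStep a b) p q) → FlipTowards c (a ∷ p) (b ∷ q)
  extendBelow a np with c ℤ.≤? 0ℤ
  ... | yes c≤0 = below (c≤0 ∷ np)
  extendBelow U np | no c≰0 = pending (ℤ.≰⇒> c≰0) headU
  extendBelow D np | no c≰0 =
    contradiction (ℤ.<-≤-trans (ℤ.≰⇒> c≰0) (c≤c+gapStep-D c b)) (ℤ.≤⇒≯ (head-heightsFrom (A p q) np))
... | pending pos s = extendPending a pos
  where
  extendPending : ∀ a → 0ℤ < c + gapStep a b → FlipTowards c (a ∷ p) (b ∷ q)
  extendPending U pos = pending (ℤ.<-≤-trans pos (c+gapStep-U≤c c b)) headU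
  extendPending D pos = valleyFlip c b p q s pos

data Towards {n} (p q : Q n) : Set where
  arrived : p ≡ q → Towards p q
  up      : ∀ r → p ⋖ r → gapSize 0ℤ p q ≡ suc (gapSize 0ℤ r q) → Towards p q
  down    : ∀ r → q ⋖ r → gapSize 0ℤ p q ≡ suc (gapSize 0ℤ p r) → Towards p q

towards : ∀ {n} (p q : Q n) → Towards p q
towards p q with flipTowards 0ℤ p q
... | flipUp r f d        = up r (flip⇒⋖ f) (absSum-decrement d)
... | pending (+<+ ()) _
... | below np with flipTowards 0ℤ q p
...   | flipUp r f d       = down r (flip⇒⋖ f) (begin
        gapSize 0ℤ p q       ≡⟨ gapSize-sym q p ⟩
        gapSize 0ℤ q p       ≡⟨ absSum-decrement d ⟩
        suc (gapSize 0ℤ r p) ≡⟨ cong suc (gapSize-sym p r) ⟩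
        suc (gapSize 0ℤ p r) ∎)
...   | pending (+<+ ()) _
...   | below np′          =
        arrived (nonNeg-antisym p q (nonPos⇒nonNeg-swap np′) (nonPos⇒nonNeg-swap np))

snoc : ∀ {n} {p r q : Q n} {k} → Walk p r k → HasseAdj r q → Walk p q (suc k)
snoc nil        adj = cons adj nil
snoc (cons a w) adj = cons a (snoc w adj)

walk : ∀ {n} k (p q : Q n) → gapSize 0ℤ p q ≡ k → Walk p q k
walk k p q e with towards p q
walk zero    p .p e | arrived refl = nil
walk (suc k) p .p e | arrived refl = contradiction (trans (sym e) (gapSize-refl p)) ℕ.1+n≢0
walk zero    p q  e | up _ _ e′    = contradiction (trans (sym e′) e) ℕ.1+n≢0
walk (suc k) p q  e | up r p⋖r e′  = cons (inj₁ p⋖r) (walk k r q (ℕ.suc-injective (trans (sym e′) e)))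
walk zero    p q  e | down _ _ e′  = contradiction (trans (sym e′) e) ℕ.1+n≢0
walk (suc k) p q  e | down r q⋖r e′ = snoc (walk k p r (ℕ.suc-injective (trans (sym e′) e))) (inj₂ q⋖r)

⋖⇒gapSize≤1 : ∀ {n} {p q : Q n} → p ⋖ q → gapSize 0ℤ p q ℕ.≤ 1
⋖⇒gapSize≤1 {p = p} {q} (p≤q , p≢q , between) with flipTowards 0ℤ p q
... | pending (+<+ ()) _
... | below np = contradiction (nonNeg-antisym p q (≤Q⇒nonNeg p≤q) (nonPos⇒nonNeg-swap np)) p≢q
... | flipUp r f d
    with between r (nonNeg⇒≤Q (flip-nonNeg f)) (nonNeg⇒≤Q (nonNeg-decrement d (≤Q⇒nonNeg p≤q)))
...   | inj₁ r≡p  = contradiction (sym r≡p) (flip-≢ f)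
...   | inj₂ refl = ℕ.≤-reflexive (trans (absSum-decrement d) (cong suc (gapSize-refl r)))

adj⇒gapSize≤1 : ∀ {n} {p q : Q n} → HasseAdj p q → gapSize 0ℤ p q ℕ.≤ 1
adj⇒gapSize≤1         (inj₁ p⋖q) = ⋖⇒gapSize≤1 p⋖q
adj⇒gapSize≤1 {p = p} {q} (inj₂ q⋖p) = subst (ℕ._≤ 1) (gapSize-sym p q) (⋖⇒gapSize≤1 q⋖p)

gapSize≤length : ∀ {n} {p q : Q n} {m} → Walk p q m → gapSize 0ℤ p q ℕ.≤ m
gapSize≤length {p = p} nil = ℕ.≤-reflexive (gapSize-refl p)
gapSize≤length {p = p} {q} (cons {r = r} adj w) =
  ℕ.≤-trans (gapSize-triangle p r q) (ℕ.+-mono-≤ (adj⇒gapSize≤1 adj) (gapSize≤length w))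

hasseDist : ∀ {n} (p q : Q n) → HasseDist p q (dbar (A p q))
hasseDist p q rewrite dbar≡gapSize p q = walk _ p q refl , λ _ → gapSize≤length

proposition5p2 : (n : ℕ) →
    Bijective _≡_ _≡_ (Apair {n})
    × (∀ (p q : Q n) → HasseDist p q (dbar (A p q)))
    × (∀ (p q : Q n) → p ≤Q q → InN (A p q))
    × (∀ (v : V n) → InN v → ∃[ p ] ∃[ q ] (p ≤Q q × A p q ≡ v))
proposition5p2 n = A-bijective , hasseDist , ≤Q⇒InN ,
  λ v v∈N → let (p , q) = A⁻¹ v in p , q , InN⇒≤Q p q (subst InN (sym (A-A⁻¹ v)) v∈N) , A-A⁻¹ v
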